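{- Let $\ell\geq 3$ be an integer, let $G$ be a graph with girth exactly $2\ell$ and no even hole of length at least $2\ell+2$, and let $C$ be an even hole of $G$. Then every vertex of $G$ not in $C$ has at most one neighbour in $C$.
   Context: A hole is an induced cycle of length at least four; it is even if its length is even. The girth is the minimum length of a cycle. -}

module Defs where

open import Level using (0ℓ)
open import Data.Nat using (ℕ; zero; suc; _+_; _*_; _≤_; _<_; _%_)
open import Data.Nat.DivMod using (m%n<n)
open import Data.Fin using (Fin; toℕ; fromℕ<)
open import Data.Product using (Σ; _×_; ∃)
open import Data.Sum using (_⊎_)
open import Relation.Nullary using (¬_; Dec)
open import Relation.Binary.PropositionalEquality using (_≡_)

record Graph : Set₁ where
  field
    n     : ℕ
    Adj   : Fin n → Fin n → Set
    sym   : ∀ {u v} → Adj u v → Adj v u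
    irr   : ∀ {v} → ¬ Adj v v
    adj?  : ∀ u v → Dec (Adj u v)

  Vertex : Set
  Vertex = Fin n

next : ∀ {k} → Fin k → Fin k
next {suc m} i = fromℕ< (m%n<n (suc (toℕ i)) (suc m))

record Cycle (G : Graph) (k : ℕ) : Set where
  open Graph G
  field
    len≥3  : 3 ≤ k
    vert   : Fin k → Vertex
    inj    : ∀ i j → vert i ≡ vert j → i ≡ j
    edge   : ∀ i → Adj (vert i) (vert (next i))

Induced : ∀ {G k} → Cycle G k → Set
Induced {G} C = ∀ i j → Adj (vert i) (vert j) → (j ≡ next i) ⊎ (i ≡ next j)
  where open Graph G
        open Cycle C

record Hole (G : Graph) (k : ℕ) : Set where
  field
    cycle   : Cycle G k
    len≥4   : 4 ≤ k
    induced : Induced cycle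

record EvenHole (G : Graph) (k : ℕ) : Set where
  field
    hole : Hole G k
    even : Σ ℕ (λ m → k ≡ m + m)

HasGirth : Graph → ℕ → Set
HasGirth G g = Cycle G g × (∀ k → k < g → ¬ Cycle G k)

OnCycle : ∀ {G k} → Cycle G k → Graph.Vertex G → Set
OnCycle {k = k} C v = Σ (Fin k) (λ i → Cycle.vert C i ≡ v)

{-# OPTIONS --safe #-}
module Submission where

-- C is itself an even hole, so its length is at most 2ℓ + 1. Two distinct neighbours
-- of v split C into two arcs, the shorter of length e ≤ ℓ; together with v it closes
-- into a cycle of length e + 2 ≤ ℓ + 2 < 2ℓ, contradicting the girth.

open import Defs
open import Data.Nat using (ℕ; _≤_; _+_; _*_)
open import Data.Fin using (Fin)
open import Relation.Nullary using (¬_)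
open import Relation.Binary.PropositionalEquality using (_≡_)

open import Data.Nat using (zero; suc; _<_; _∸_; _%_; s≤s; NonZero; ⌊_/2⌋)
open import Data.Nat.Properties
open import Data.Nat.DivMod
open import Data.Nat.Divisibility using (_∣_; divides; ∣-refl; >⇒∤)
open import Data.Fin using (toℕ)
open import Data.Fin.Properties using (toℕ-injective; toℕ-fromℕ<; toℕ<n; toℕ≤pred[n])
import Data.Fin.Properties as Fin
open import Data.Product using (Σ; _×_; _,_)
open import Data.Sum using (inj₁; inj₂; [_,_]′)
open import Function using (_∘_)
open import Relation.Binary.Definitions using (tri<; tri≈; tri>)
open import Relation.Nullary using (yes; no; contradiction)
open import Relation.Binary.PropositionalEquality using (refl; sym; trans; cong; cong₂; subst; _≢_; module ≡-Reasoning)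

m%n≡o%n⇒n∣m∸o : ∀ m o {n} .{{_ : NonZero n}} → m % n ≡ o % n → n ∣ m ∸ o
m%n≡o%n⇒n∣m∸o m o {n} eq = divides (m / n ∸ o / n) (begin
  m ∸ o                                      ≡⟨ cong₂ _∸_ (m≡m%n+[m/n]*n m n) (m≡m%n+[m/n]*n o n) ⟩
  (m % n + m / n * n) ∸ (o % n + o / n * n)  ≡⟨ cong (λ r → (m % n + m / n * n) ∸ (r + o / n * n)) eq ⟨
  (m % n + m / n * n) ∸ (m % n + o / n * n)  ≡⟨ [m+n]∸[m+o]≡n∸o (m % n) (m / n * n) (o / n * n) ⟩
  m / n * n ∸ o / n * n                      ≡⟨ *-distribʳ-∸ n (m / n) (o / n) ⟨
  (m / n ∸ o / n) * n                        ∎)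
  where open ≡-Reasoning

n∣m∧m<n⇒m≡0 : ∀ {m n} → n ∣ m → m < n → m ≡ 0
n∣m∧m<n⇒m≡0 {zero}  _   _   = refl
n∣m∧m<n⇒m≡0 {suc _} n∣m m<n = contradiction n∣m (>⇒∤ m<n)

%-injective-window : ∀ {m o n} .{{_ : NonZero n}} → m ≤ o → o < m + n → m % n ≡ o % n → m ≡ o
%-injective-window {m} {o} m≤o o<m+n eq =
  ≤-antisym m≤o (m∸n≡0⇒m≤n (n∣m∧m<n⇒m≡0 (m%n≡o%n⇒n∣m∸o o m (sym eq)) (m<n+o⇒m∸n<o o m o<m+n)))

+-%-cancelʳ-< : ∀ {n} .{{_ : NonZero n}} s {u w} → u < n → w < n → (u + s) % n ≡ (w + s) % n → u ≡ w
+-%-cancelʳ-< {n} s {u} {w} u<n w<n eq =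
  [ (λ u≤w → cancel u≤w w<n eq) , (λ w≤u → sym (cancel w≤u u<n (sym eq))) ]′ (≤-total u w)
  where
  cancel : ∀ {u w} → u ≤ w → w < n → (u + s) % n ≡ (w + s) % n → u ≡ w
  cancel {u} {w} u≤w w<n eq = +-cancelʳ-≡ s u w (%-injective-window (+-monoˡ-≤ s u≤w) w+s<u+s+n eq)
    where
    open ≤-Reasoning
    w+s<u+s+n : w + s < u + s + n
    w+s<u+s+n = begin-strict
      w + s        <⟨ +-monoˡ-< s w<n ⟩
      n + s        ≤⟨ +-monoʳ-≤ n (m≤n+m s u) ⟩
      n + (u + s)  ≡⟨ +-comm n (u + s) ⟩
      u + s + n    ∎

toℕ-next : ∀ {k} (i : Fin (suc k)) → toℕ (next i) ≡ suc (toℕ i) % suc k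
toℕ-next {k} i = toℕ-fromℕ< (m%n<n (suc (toℕ i)) (suc k))

next-mod : ∀ {k} m → next (m mod suc k) ≡ suc m mod suc k
next-mod {k} m = toℕ-injective (begin
  toℕ (next (m mod K))       ≡⟨ toℕ-next (m mod K) ⟩
  suc (toℕ (m mod K)) % K    ≡⟨ cong (λ r → suc r % K) (toℕ-fromℕ< _) ⟩
  (1 + m % K) % K            ≡⟨ %-distribˡ-+ 1 (m % K) K ⟩
  (1 % K + m % K % K) % K    ≡⟨ cong (λ r → (1 % K + r) % K) (m%n%n≡m%n m K) ⟩
  (1 % K + m % K) % K        ≡⟨ %-distribˡ-+ 1 m K ⟨
  suc m % K                  ≡⟨ toℕ-fromℕ< _ ⟨
  toℕ (suc m mod K)          ∎)
  where
  K = suc k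
  open ≡-Reasoning

%≡toℕ⇒mod≡ : ∀ {k} m (i : Fin (suc k)) → m % suc k ≡ toℕ i → m mod suc k ≡ i
%≡toℕ⇒mod≡ m i eq = toℕ-injective (trans (toℕ-fromℕ< _) eq)

module _ {G : Graph} where
  open Graph G using (Vertex; Adj) renaming (sym to Adj-sym)

  closedWalk⇒Cycle : ∀ m (f : ℕ → Vertex) → 2 ≤ m
    → (∀ u → u < m → Adj (f u) (f (suc u)))
    → Adj (f m) (f 0)
    → (∀ u w → u ≤ m → w ≤ m → f u ≡ f w → u ≡ w)
    → Cycle G (suc m)
  closedWalk⇒Cycle m f 2≤m step close f-inj = record
    { len≥3 = s≤s 2≤m
    ; vert  = f ∘ toℕ
    ; inj   = λ x y eq → toℕ-injective (f-inj (toℕ x) (toℕ y) (toℕ≤pred[n] x) (toℕ≤pred[n] y) eq)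
    ; edge  = edge
    }
    where
    edge : ∀ (x : Fin (suc m)) → Adj (f (toℕ x)) (f (toℕ (next x)))
    edge x rewrite toℕ-next x with m≤n⇒m<n∨m≡n (toℕ≤pred[n] x)
    ... | inj₁ x<m rewrite m<n⇒m%n≡m (s≤s x<m) = step (toℕ x) x<m
    ... | inj₂ x≡m rewrite x≡m = subst (Adj (f m) ∘ f) (sym (n%n≡0 (suc m))) close

  module _ {k} (C : Cycle G (suc k)) where
    open Cycle C

    arcCycle : ∀ {v} → ¬ OnCycle C v → ∀ {i j} e → 0 < e → e < suc k → (e + toℕ i) % suc k ≡ toℕ j
      → Adj v (vert i) → Adj v (vert j) → Cycle G (2 + e)
    arcCycle {v} v∉C {i} {j} e 0<e e<K e+i≡j vi vj =
      closedWalk⇒Cycle (suc e) walk (s≤s 0<e) step close walk-inj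
      where
      K = suc k
      walk : ℕ → Vertex
      walk zero    = v
      walk (suc u) = vert ((u + toℕ i) mod K)
      step : ∀ u → u < suc e → Adj (walk u) (walk (suc u))
      step zero    _ = subst (Adj v ∘ vert) (sym (%≡toℕ⇒mod≡ (toℕ i) i (m<n⇒m%n≡m (toℕ<n i)))) vi
      step (suc u) _ = subst (Adj (walk (suc u)) ∘ vert) (next-mod (u + toℕ i)) (edge _)
      close : Adj (walk (suc e)) v
      close = Adj-sym (subst (Adj v ∘ vert) (sym (%≡toℕ⇒mod≡ (e + toℕ i) j e+i≡j)) vj)
      walk-inj : ∀ u w → u ≤ suc e → w ≤ suc e → walk u ≡ walk w → u ≡ w
      walk-inj zero    zero    _ _ _  = refl
      walk-inj zero    (suc w) _ _ eq = contradiction (_ , sym eq) v∉C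
      walk-inj (suc u) zero    _ _ eq = contradiction (_ , eq) v∉C
      walk-inj (suc u) (suc w) (s≤s u≤e) (s≤s w≤e) eq =
        cong suc (+-%-cancelʳ-< (toℕ i) (≤-<-trans u≤e e<K) (≤-<-trans w≤e e<K)
          (trans (sym (toℕ-fromℕ< _)) (trans (cong toℕ (inj _ _ eq)) (toℕ-fromℕ< _))))

    shorterArcCycle : ∀ {v} → ¬ OnCycle C v → ∀ {i j} → toℕ i < toℕ j → Adj v (vert i) → Adj v (vert j)
      → Σ ℕ λ e → e + e ≤ suc k × Cycle G (2 + e)
    shorterArcCycle v∉C {i} {j} i<j vi vj = [ forward , backward ]′ (≤-total (d + d) K)
      where
      K = suc k
      a = toℕ i
      b = toℕ j
      d = b ∸ a
      d+a≡b : d + a ≡ b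
      d+a≡b = m∸n+n≡m (<⇒≤ i<j)
      0<d : 0 < d
      0<d = m<n⇒0<n∸m i<j
      d<K : d < K
      d<K = ≤-<-trans (m∸n≤m b a) (toℕ<n j)
      forward : d + d ≤ K → Σ ℕ λ e → e + e ≤ K × Cycle G (2 + e)
      forward 2d≤K = d , 2d≤K , arcCycle v∉C d 0<d d<K d+a%K≡b vi vj
        where
        d+a%K≡b : (d + a) % K ≡ b
        d+a%K≡b = trans (cong (_% K) d+a≡b) (m<n⇒m%n≡m (toℕ<n j))
      backward : K ≤ d + d → Σ ℕ λ e → e + e ≤ K × Cycle G (2 + e)
      backward K≤2d = e , 2e≤K , arcCycle v∉C e (m<n⇒0<n∸m d<K) (∸-monoʳ-< 0<d (<⇒≤ d<K)) e+b%K≡a vj vi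
        where
        open ≡-Reasoning
        e = K ∸ d
        e+d≡K : e + d ≡ K
        e+d≡K = m∸n+n≡m (<⇒≤ d<K)
        2e≤K : e + e ≤ K
        2e≤K = ≤-trans (+-monoʳ-≤ e (m≤n+o⇒m∸n≤o K d K≤2d)) (≤-reflexive e+d≡K)
        e+b%K≡a : (e + b) % K ≡ a
        e+b%K≡a = begin
          (e + b) % K        ≡⟨ cong (λ x → (e + x) % K) d+a≡b ⟨
          (e + (d + a)) % K  ≡⟨ cong (_% K) (+-assoc e d a) ⟨
          (e + d + a) % K    ≡⟨ cong (λ x → (x + a) % K) e+d≡K ⟩
          (K + a) % K        ≡⟨ %-remove-+ˡ a ∣-refl ⟩
          a % K              ≡⟨ m<n⇒m%n≡m (toℕ<n i) ⟩
          a                  ∎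

    twoNeighbours⇒shortCycle : ∀ {v} → ¬ OnCycle C v → ∀ {i j} → i ≢ j → Adj v (vert i) → Adj v (vert j)
      → Σ ℕ λ e → e + e ≤ suc k × Cycle G (2 + e)
    twoNeighbours⇒shortCycle v∉C {i} {j} i≢j vi vj with Fin.<-cmp i j
    ... | tri< i<j _ _ = shorterArcCycle v∉C i<j vi vj
    ... | tri≈ _ i≡j _ = contradiction i≡j i≢j
    ... | tri> _ _ j<i = shorterArcCycle v∉C j<i vj vi

lemma2p3 : (ℓ : ℕ) → 3 ≤ ℓ → (G : Graph) → HasGirth G (2 * ℓ)
    → (∀ k → 2 * ℓ + 2 ≤ k → ¬ EvenHole G k)
    → ∀ {k} (C : EvenHole G k) → (v : Graph.Vertex G)
    → ¬ OnCycle (Hole.cycle (EvenHole.hole C)) v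
    → ∀ (i j : Fin k)
    → Graph.Adj G v (Cycle.vert (Hole.cycle (EvenHole.hole C)) i)
    → Graph.Adj G v (Cycle.vert (Hole.cycle (EvenHole.hole C)) j)
    → i ≡ j
lemma2p3 _ _ _ _ _ {zero} _ _ _ ()
lemma2p3 ℓ 3≤ℓ G (_ , noShortCycle) noLongEvenHole {suc k} C v v∉C i j vi vj with i Fin.≟ j
... | yes i≡j = i≡j
... | no i≢j with twoNeighbours⇒shortCycle (Hole.cycle (EvenHole.hole C)) v∉C i≢j vi vj
...   | e , e+e≤K , cycle = contradiction cycle (noShortCycle (2 + e) 2+e<2ℓ)
  where
  open ≤-Reasoning
  2ℓ≡ℓ+ℓ : 2 * ℓ ≡ ℓ + ℓ
  2ℓ≡ℓ+ℓ = cong (ℓ +_) (+-identityʳ ℓ)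
  K≤1+ℓ+ℓ : suc k ≤ suc (ℓ + ℓ)
  K≤1+ℓ+ℓ = ≮⇒≥ λ long → noLongEvenHole (suc k) (subst (_≤ suc k) 2+ℓ+ℓ≡2ℓ+2 long) C
    where
    2+ℓ+ℓ≡2ℓ+2 : 2 + (ℓ + ℓ) ≡ 2 * ℓ + 2
    2+ℓ+ℓ≡2ℓ+2 = trans (cong (2 +_) (sym 2ℓ≡ℓ+ℓ)) (+-comm 2 (2 * ℓ))
  e≤ℓ : e ≤ ℓ
  e≤ℓ = begin
    e                    ≡⟨ n≡⌊n+n/2⌋ e ⟩
    ⌊ e + e /2⌋          ≤⟨ ⌊n/2⌋-mono (≤-trans e+e≤K K≤1+ℓ+ℓ) ⟩
    ⌊ suc (ℓ + ℓ) /2⌋    ≡⟨ n≡⌈n+n/2⌉ ℓ ⟨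
    ℓ                    ∎
  2+e<2ℓ : 2 + e < 2 * ℓ
  2+e<2ℓ = subst (3 + e ≤_) (sym 2ℓ≡ℓ+ℓ) (+-mono-≤ 3≤ℓ e≤ℓ)
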